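{- If $G=(V,E)$ is a uniformly dense graph (with at least one edge), then its clique number satisfies $\operatorname{cl}(G)\le 2\rho(G)$.
   Context: Graphs are finite and simple. For $A\subseteq E$, $\operatorname{rank}(A)=|V|-c(A)$ where $c(A)$ is the number of connected components of $(V,A)$; $\rho(A)=|A|/\operatorname{rank}(A)$ for nonempty $A$, $\rho(G)=\rho(E)$. $G$ is uniformly dense if $\rho(A)\le\rho(E)$ for all nonempty $A\subseteq E$. $\operatorname{cl}(G)$ is the largest size of a set of pairwise adjacent vertices. -}

module Defs where

open import Data.Nat using (ℕ; zero; suc; _+_; _*_; _∸_; _≤_; _<_)
open import Data.Fin using (Fin; toℕ)
open import Data.Bool using (Bool; true; false; if_then_else_)
open import Data.Product using (Σ; _×_; _,_)
open import Data.List using (List)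
open import Data.List.Relation.Unary.AllPairs using (AllPairs)
open import Relation.Binary.PropositionalEquality using (_≡_)
open import Relation.Nullary using (¬_)
open import Relation.Nullary.Decidable using (⌊_⌋)
open import Data.Nat using (_<?_)
open import Function using (_⇔_)

record Graph (n : ℕ) : Set where
  field
    adj   : Fin n → Fin n → Bool
    sym   : ∀ u v → adj u v ≡ adj v u
    irref : ∀ u → adj u u ≡ false
open Graph public

sumFin : (n : ℕ) → (Fin n → ℕ) → ℕ
sumFin zero    f = 0
sumFin (suc n) f = f Data.Fin.zero + sumFin n (λ i → f (Data.Fin.suc i))

record EdgeSet (n : ℕ) : Set where
  field
    mem     : Fin n → Fin n → Bool
    mem-sym : ∀ u v → mem u v ≡ mem v u
open EdgeSet public

edges : ∀ {n} → Graph n → EdgeSet n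
edges G = record { mem = adj G ; mem-sym = sym G }

_⊆E_ : ∀ {n} → EdgeSet n → Graph n → Set
A ⊆E G = ∀ u v → mem A u v ≡ true → adj G u v ≡ true

size : ∀ {n} → EdgeSet n → ℕ
size {n} A = sumFin n (λ u → sumFin n (λ v →
  if ⌊ toℕ u <? toℕ v ⌋ then (if mem A u v then 1 else 0) else 0))

data Reach {n : ℕ} (A : EdgeSet n) : Fin n → Fin n → Set where
  here : ∀ {u} → Reach A u u
  step : ∀ {u w v} → mem A u w ≡ true → Reach A w v → Reach A u v

-- c is the number of connected components of (V, A): there is a surjective
-- labelling of vertices by Fin c whose fibres are exactly the components.
IsComponentCount : ∀ {n} → EdgeSet n → ℕ → Set
IsComponentCount {n} A c =
  Σ (Fin n → Fin c) λ f →
    (∀ (k : Fin c) → Σ (Fin n) λ u → f u ≡ k) ×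
    (∀ u v → (f u ≡ f v) ⇔ Reach A u v)

IsRank : ∀ {n} → EdgeSet n → ℕ → Set
IsRank {n} A r = Σ ℕ λ c → IsComponentCount A c × (r ≡ n ∸ c)

-- Uniformly dense: ρ(A) ≤ ρ(E) for every nonempty A ⊆ E, i.e.
-- |A| / rank(A) ≤ |E| / rank(E), written cross-multiplied.
UniformlyDense : ∀ {n} → Graph n → Set
UniformlyDense {n} G =
  ∀ (A : EdgeSet n) → A ⊆E G → 1 ≤ size A →
  ∀ rA rE → IsRank A rA → IsRank (edges G) rE →
  size A * rE ≤ size (edges G) * rA

IsClique : ∀ {n} → Graph n → List (Fin n) → Set
IsClique G K = AllPairs (λ u v → adj G u v ≡ true) K

-- A clique K of size k ≥ 2 spans the edge set A of a complete graph K_k, with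
-- |A| = k(k-1)/2 and rank(A) = k - 1 (one component K, the other vertices
-- isolated).  Uniform density gives |A| · rank(E) ≤ |E| · rank(A), i.e.
-- k · rank(E) ≤ 2|E|.  A clique with at most one vertex is handled by any edge,
-- which is a 2-clique.
module Submission where

open import Defs
open import Data.Nat using (ℕ; _≤_; _*_)
open import Data.List using (List; length)
open import Data.Fin using (Fin)

open import Data.Nat using (zero; suc; _+_; _∸_; z≤n; s≤s; _<?_)
open import Data.Nat.Properties
  using (≤-trans; ≤-pred; *-cancelʳ-≤; *-monoˡ-≤; *-monoʳ-≤; +-suc; +-comm;
         +-identityʳ; +-cancelʳ-≡; suc-injective; <-irrefl; [m+n]∸[m+o]≡n∸o;
         module ≤-Reasoning)
open import Data.Fin using (zero; suc; toℕ; fromℕ<)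
open import Data.Fin.Properties using (_≟_; toℕ-fromℕ<; toℕ-injective; toℕ<n)
open import Data.Bool using (Bool; true; false; if_then_else_; _∧_; _∨_; not)
open import Data.Bool.Properties using (∧-identityʳ; ∨-identityʳ; ∨-zeroʳ)
open import Data.Product using (Σ; _×_; _,_)
open import Data.Empty using (⊥; ⊥-elim)
open import Data.List using ([]; _∷_)
open import Data.List.Relation.Unary.All as All using (All)
open import Data.List.Relation.Unary.AllPairs as AllPairs using (AllPairs; []; _∷_)
open import Data.List.Relation.Unary.Any using (here; there)
open import Data.List.Membership.Propositional using (_∈_)
import Data.List.Membership.DecPropositional as DecMembership
open import Relation.Binary.PropositionalEquality
  using (_≡_; _≢_; refl; trans; cong; cong₂; subst; module ≡-Reasoning)
  renaming (sym to ≡-sym)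
open import Relation.Nullary using (¬_; yes; no)
open import Relation.Nullary.Decidable
  using (Dec; ⌊_⌋; isYes≗does; ⌊⌋-map′; dec-true; dec-false; does-⇔)
open import Function using (_∘_; _⇔_; mk⇔)
open import Function.Construct.Composition using (_⇔-∘_)
open import Data.Nat.Solver using (module +-*-Solver)
open +-*-Solver using (solve; _:+_; _:*_; _:=_; con)

⌊⌋-⇔ : ∀ {A B : Set} → A ⇔ B → (a? : Dec A) (b? : Dec B) → ⌊ a? ⌋ ≡ ⌊ b? ⌋
⌊⌋-⇔ A⇔B a? b? = trans (isYes≗does a?) (trans (does-⇔ A⇔B a? b?) (≡-sym (isYes≗does b?)))

⌊⌋-true : ∀ {A : Set} (a? : Dec A) → A → ⌊ a? ⌋ ≡ true
⌊⌋-true a? a = trans (isYes≗does a?) (dec-true a? a)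

⌊⌋-false : ∀ {A : Set} (a? : Dec A) → ¬ A → ⌊ a? ⌋ ≡ false
⌊⌋-false a? ¬a = trans (isYes≗does a?) (dec-false a? ¬a)

suc<?suc : ∀ a b → ⌊ suc a <? suc b ⌋ ≡ ⌊ a <? b ⌋
suc<?suc a b = ⌊⌋-⇔ (mk⇔ ≤-pred s≤s) (suc a <? suc b) (a <? b)

≟-sym : ∀ {n} (u v : Fin n) → ⌊ u ≟ v ⌋ ≡ ⌊ v ≟ u ⌋
≟-sym u v = ⌊⌋-⇔ (mk⇔ ≡-sym ≡-sym) (u ≟ v) (v ≟ u)

∧-true : ∀ {a b} → a ∧ b ≡ true → a ≡ true × b ≡ true
∧-true {true} {true} _ = refl , refl

sumFin-cong : ∀ n {f g : Fin n → ℕ} → (∀ i → f i ≡ g i) → sumFin n f ≡ sumFin n g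
sumFin-cong zero    f≗g = refl
sumFin-cong (suc n) f≗g = cong₂ _+_ (f≗g zero) (sumFin-cong n (f≗g ∘ suc))

sumFin-zero : ∀ n {f : Fin n → ℕ} → (∀ i → f i ≡ 0) → sumFin n f ≡ 0
sumFin-zero zero    f≗0 = refl
sumFin-zero (suc n) f≗0 rewrite f≗0 zero = sumFin-zero n (f≗0 ∘ suc)

sumFin-positive : ∀ n (f : Fin n → ℕ) → 1 ≤ sumFin n f → Σ (Fin n) λ i → 1 ≤ f i
sumFin-positive (suc n) f pos with f zero in f0
... | suc _ = zero , subst (1 ≤_) (≡-sym f0) (s≤s z≤n)
... | zero  = let i , fi = sumFin-positive n (f ∘ suc) pos in suc i , fi

count : ∀ n → (Fin n → Bool) → ℕ
count n S = sumFin n (λ u → if S u then 1 else 0)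

count-cong : ∀ n {S T : Fin n → Bool} → (∀ u → S u ≡ T u) → count n S ≡ count n T
count-cong n S≗T = sumFin-cong n (cong (λ b → if b then 1 else 0) ∘ S≗T)

_∖_ : ∀ {n} → (Fin n → Bool) → Fin n → (Fin n → Bool)
(S ∖ r) u = S u ∧ not ⌊ u ≟ r ⌋

∖-suc : ∀ {n} (S : Fin (suc n) → Bool) r u → ((S ∘ suc) ∖ r) u ≡ (S ∖ suc r) (suc u)
∖-suc S r u = cong (λ b → S (suc u) ∧ not b) (≡-sym (⌊⌋-map′ _ _ (u ≟ r)))

count-∖ : ∀ n (S : Fin n → Bool) {r} → S r ≡ true → count n S ≡ suc (count n (S ∖ r))
count-∖ (suc n) S {zero} Sr rewrite Sr =
  cong suc (count-cong n (λ u → ≡-sym (∧-identityʳ (S (suc u)))))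
count-∖ (suc n) S {suc r} Sr with S zero
... | true  = cong suc (trans (count-∖ n (S ∘ suc) Sr) (cong suc (count-cong n (∖-suc S r))))
... | false = trans (count-∖ n (S ∘ suc) Sr) (cong suc (count-cong n (∖-suc S r)))

count-not+count : ∀ n (S : Fin n → Bool) → count n (not ∘ S) + count n S ≡ n
count-not+count zero    S = refl
count-not+count (suc n) S with S zero
... | true  = trans (+-suc _ _) (cong suc (count-not+count n (S ∘ suc)))
... | false = cong suc (count-not+count n (S ∘ suc))

length≤count : ∀ {n} (S : Fin n → Bool) {K : List (Fin n)} →
  AllPairs _≢_ K → All (λ u → S u ≡ true) K → length K ≤ count n S
length≤count S []                 _             = z≤n
length≤count {n} S {x ∷ K} (x∉K ∷ distinct) (Sx All.∷ SK) =
  subst (suc (length K) ≤_) (≡-sym (count-∖ n S Sx))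
    (s≤s (length≤count (S ∖ x) distinct (All.zipWith in-S∖x (x∉K , SK))))
  where
    in-S∖x : ∀ {y} → x ≢ y × S y ≡ true → (S ∖ x) y ≡ true
    in-S∖x {y} (x≢y , Sy) rewrite Sy | ⌊⌋-false (y ≟ x) (x≢y ∘ ≡-sym) = refl

position : ∀ {n} → (Fin n → Bool) → Fin n → ℕ
position R zero    = 0
position R (suc u) = (if R zero then 1 else 0) + position (R ∘ suc) u

position<count : ∀ {n} (R : Fin n → Bool) {u} → R u ≡ true → suc (position R u) ≤ count n R
position<count R {zero} Ru rewrite Ru = s≤s z≤n
position<count R {suc u} Ru with R zero
... | true  = s≤s (position<count (R ∘ suc) Ru)
... | false = position<count (R ∘ suc) Ru

position-injective : ∀ {n} (R : Fin n → Bool) {u v} → R u ≡ true → R v ≡ true →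
  position R u ≡ position R v → u ≡ v
position-injective R {zero}  {zero}  Ru Rv eq = refl
position-injective R {zero}  {suc v} Ru Rv eq rewrite Ru with () ← eq
position-injective R {suc u} {zero}  Ru Rv eq rewrite Rv with () ← eq
position-injective R {suc u} {suc v} Ru Rv eq with R zero
... | true  = cong suc (position-injective (R ∘ suc) Ru Rv (suc-injective eq))
... | false = cong suc (position-injective (R ∘ suc) Ru Rv eq)

position-surjective : ∀ {n} (R : Fin n → Bool) k → suc k ≤ count n R →
  Σ (Fin n) λ u → R u ≡ true × position R u ≡ k
position-surjective {suc n} R k k<count with R zero in R0
position-surjective {suc n} R zero    _             | true = zero , R0 , refl
position-surjective {suc n} R (suc k) (s≤s k<count) | true =
  let u , Ru , pos = position-surjective (R ∘ suc) k k<count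
  in  suc u , Ru , subst (λ b → (if b then 1 else 0) + position (R ∘ suc) u ≡ suc k) (≡-sym R0) (cong suc pos)
position-surjective {suc n} R k k<count | false =
  let u , Ru , pos = position-surjective (R ∘ suc) k k<count
  in  suc u , Ru , subst (λ b → (if b then 1 else 0) + position (R ∘ suc) u ≡ k) (≡-sym R0) pos

isComponentCount-byRepresentatives :
  ∀ {n} (A : EdgeSet n) (R : Fin n → Bool) (rep : Fin n → Fin n) →
  (∀ u → R (rep u) ≡ true) → (∀ u → R u ≡ true → rep u ≡ u) →
  (∀ u v → (rep u ≡ rep v) ⇔ Reach A u v) →
  IsComponentCount A (count n R)
isComponentCount-byRepresentatives {n} A R rep R-rep rep-fixes rep⇔Reach =
  label , label-surjective , λ u v → rep⇔Reach u v ⇔-∘ label⇔rep u v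
  where
    label : Fin n → Fin (count n R)
    label u = fromℕ< (position<count R (R-rep u))

    toℕ-label : ∀ u → toℕ (label u) ≡ position R (rep u)
    toℕ-label u = toℕ-fromℕ< (position<count R (R-rep u))

    label-surjective : ∀ k → Σ (Fin n) λ u → label u ≡ k
    label-surjective k =
      let u , Ru , pos = position-surjective R (toℕ k) (toℕ<n k)
      in  u , toℕ-injective (trans (toℕ-label u) (trans (cong (position R) (rep-fixes u Ru)) pos))

    label⇔rep : ∀ u v → (label u ≡ label v) ⇔ (rep u ≡ rep v)
    label⇔rep u v = mk⇔
      (λ eq → position-injective R (R-rep u) (R-rep v)
                (trans (≡-sym (toℕ-label u)) (trans (cong toℕ eq) (toℕ-label v))))
      (λ eq → toℕ-injective (trans (toℕ-label u) (trans (cong (position R) eq) (≡-sym (toℕ-label v)))))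

completeOn : ∀ {n} → (Fin n → Bool) → EdgeSet n
completeOn {n} S = record { mem = joined ; mem-sym = joined-sym }
  where
    joined : Fin n → Fin n → Bool
    joined u v = S u ∧ S v ∧ not ⌊ u ≟ v ⌋

    joined-sym : ∀ u v → joined u v ≡ joined v u
    joined-sym u v rewrite ≟-sym u v with S u | S v
    ... | true  | true  = refl
    ... | true  | false = refl
    ... | false | true  = refl
    ... | false | false = refl

completeOn-mem⁻ : ∀ {n} (S : Fin n → Bool) {u v} → mem (completeOn S) u v ≡ true →
  S u ≡ true × S v ≡ true × u ≢ v
completeOn-mem⁻ S {u} {v} joined with ∧-true joined
... | Su , rest with ∧-true rest
... | Sv , u≠v = Su , Sv , λ u≡v → different u≡v u≠v
  where
    different : u ≡ v → not ⌊ u ≟ v ⌋ ≡ true → ⊥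
    different refl u≠u with () ← trans (≡-sym u≠u) (cong not (⌊⌋-true (u ≟ u) refl))

completeOn-mem⁺ : ∀ {n} (S : Fin n → Bool) {u v} → S u ≡ true → S v ≡ true → u ≢ v →
  mem (completeOn S) u v ≡ true
completeOn-mem⁺ S {u} {v} Su Sv u≢v rewrite Su | Sv | ⌊⌋-false (u ≟ v) u≢v = refl

pairCount : ∀ n → (Fin n → Bool) → ℕ
pairCount n S = sumFin n (λ u → sumFin n (λ v →
  if ⌊ toℕ u <? toℕ v ⌋ then (if S u ∧ S v then 1 else 0) else 0))

pairCount-suc : ∀ n (S : Fin (suc n) → Bool) →
  pairCount (suc n) S ≡ (if S zero then count n (S ∘ suc) else 0) + pairCount n (S ∘ suc)
pairCount-suc n S = cong₂ _+_ pairs-with-zero pairs-without-zero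
  where
    pairs-with-zero : sumFin n (λ v → if S zero ∧ S (suc v) then 1 else 0)
                    ≡ (if S zero then count n (S ∘ suc) else 0)
    pairs-with-zero with S zero
    ... | true  = refl
    ... | false = sumFin-zero n (λ _ → refl)

    pairs-without-zero : sumFin n (λ u → sumFin n (λ v →
        if ⌊ suc (toℕ u) <? suc (toℕ v) ⌋ then (if S (suc u) ∧ S (suc v) then 1 else 0) else 0))
      ≡ pairCount n (S ∘ suc)
    pairs-without-zero = sumFin-cong n (λ u → sumFin-cong n (λ v →
      cong (λ b → if b then (if S (suc u) ∧ S (suc v) then 1 else 0) else 0) (suc<?suc (toℕ u) (toℕ v))))

pairCount*2+count : ∀ n (S : Fin n → Bool) → pairCount n S * 2 + count n S ≡ count n S * count n S
pairCount*2+count zero    S = refl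
pairCount*2+count (suc n) S rewrite pairCount-suc n S with S zero
... | false = pairCount*2+count n (S ∘ suc)
... | true  = begin
    (c + p) * 2 + suc c        ≡⟨ solve 2 (λ c p → (c :+ p) :* con 2 :+ (con 1 :+ c)
                                                   := con 1 :+ (c :+ c) :+ (p :* con 2 :+ c)) refl c p ⟩
    suc (c + c) + (p * 2 + c)  ≡⟨ cong (suc (c + c) +_) (pairCount*2+count n (S ∘ suc)) ⟩
    suc (c + c) + c * c        ≡⟨ solve 1 (λ c → con 1 :+ (c :+ c) :+ c :* c
                                                   := (con 1 :+ c) :* (con 1 :+ c)) refl c ⟩
    suc c * suc c              ∎
  where
    open ≡-Reasoning
    c = count n (S ∘ suc)
    p = pairCount n (S ∘ suc)

size-completeOn : ∀ {n} (S : Fin n → Bool) → size (completeOn S) ≡ pairCount n S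
size-completeOn {n} S = sumFin-cong n (λ u → sumFin-cong n (λ v → ordered-pair u v))
  where
    ordered-pair : ∀ u v →
        (if ⌊ toℕ u <? toℕ v ⌋ then (if mem (completeOn S) u v then 1 else 0) else 0)
      ≡ (if ⌊ toℕ u <? toℕ v ⌋ then (if S u ∧ S v then 1 else 0) else 0)
    ordered-pair u v with toℕ u <? toℕ v
    ... | no _ = refl
    ... | yes u<v rewrite ⌊⌋-false (u ≟ v) (λ u≡v → <-irrefl (cong toℕ u≡v) u<v) with S u | S v
    ... | true  | true  = refl
    ... | true  | false = refl
    ... | false | _     = refl

halve-square : ∀ t k → t * 2 + k ≡ k * k → t * 2 ≡ k * (k ∸ 1)
halve-square t zero    eq = trans (≡-sym (+-identityʳ (t * 2))) eq
halve-square t (suc k) eq = +-cancelʳ-≡ (suc k) (t * 2) (suc k * k) (trans eq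
  (solve 1 (λ k → (con 1 :+ k) :* (con 1 :+ k) := (con 1 :+ k) :* k :+ (con 1 :+ k)) refl k))

size-completeOn*2 : ∀ {n} (S : Fin n → Bool) →
  size (completeOn S) * 2 ≡ count n S * (count n S ∸ 1)
size-completeOn*2 {n} S rewrite size-completeOn S =
  halve-square (pairCount n S) (count n S) (pairCount*2+count n S)

module _ {n} (S : Fin n → Bool) {r : Fin n} (Sr : S r ≡ true) where
  private
    collapse : Fin n → Fin n
    collapse u = if S u then r else u

    IsRepresentative : Fin n → Bool
    IsRepresentative u = not (S u) ∨ ⌊ u ≟ r ⌋

    r-isRepresentative : IsRepresentative r ≡ true
    r-isRepresentative rewrite ⌊⌋-true (r ≟ r) refl = ∨-zeroʳ (not (S r))

    collapse-isRepresentative : ∀ u → IsRepresentative (collapse u) ≡ true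
    collapse-isRepresentative u with S u in Su
    ... | true  = r-isRepresentative
    ... | false = subst (λ b → not b ∨ ⌊ u ≟ r ⌋ ≡ true) (≡-sym Su) refl

    collapse-fixes : ∀ u → IsRepresentative u ≡ true → collapse u ≡ u
    collapse-fixes u u-rep with S u | u ≟ r
    ... | false | _       = refl
    ... | true  | yes u≡r = ≡-sym u≡r
    ... | true  | no  _   with () ← u-rep

    collapse-in : ∀ {u} → S u ≡ true → collapse u ≡ r
    collapse-in {u} Su = cong (λ b → if b then r else u) Su

    Reach⇒collapse : ∀ {u v} → Reach (completeOn S) u v → collapse u ≡ collapse v
    Reach⇒collapse here = refl
    Reach⇒collapse (step joined path) =
      let Su , Sw , _ = completeOn-mem⁻ S joined
      in  trans (trans (collapse-in Su) (≡-sym (collapse-in Sw))) (Reach⇒collapse path)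

    collapse⇒Reach : ∀ u v → collapse u ≡ collapse v → Reach (completeOn S) u v
    collapse⇒Reach u v eq with S u in Su | S v in Sv
    ... | true  | true with u ≟ v
    ...   | yes refl = here
    ...   | no  u≢v  = step (completeOn-mem⁺ S Su Sv u≢v) here
    collapse⇒Reach u v eq | true  | false with () ← trans (≡-sym Sr) (subst (λ w → S w ≡ false) (≡-sym eq) Sv)
    collapse⇒Reach u v eq | false | true  with () ← trans (≡-sym Sr) (subst (λ w → S w ≡ false) eq Su)
    collapse⇒Reach u v eq | false | false = subst (Reach (completeOn S) u) eq here

    count-representatives : count n IsRepresentative ≡ suc (count n (not ∘ S))
    count-representatives =
      trans (count-∖ n IsRepresentative r-isRepresentative) (cong suc (count-cong n others))
      where
        others : ∀ u → (IsRepresentative ∖ r) u ≡ not (S u)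
        others u with u ≟ r
        ... | yes refl rewrite Sr = refl
        ... | no  _    = trans (∧-identityʳ _) (∨-identityʳ _)

  rank-completeOn : IsRank (completeOn S) (count n S ∸ 1)
  rank-completeOn =
    count n IsRepresentative ,
    isComponentCount-byRepresentatives (completeOn S) IsRepresentative collapse
      collapse-isRepresentative collapse-fixes
      (λ u v → mk⇔ (collapse⇒Reach u v) Reach⇒collapse) ,
    rank-equation
    where
      open ≡-Reasoning
      outside = count n (not ∘ S)
      rank-equation : count n S ∸ 1 ≡ n ∸ count n IsRepresentative
      rank-equation = begin
        count n S ∸ 1                               ≡⟨ ≡-sym ([m+n]∸[m+o]≡n∸o outside (count n S) 1) ⟩
        (outside + count n S) ∸ (outside + 1)       ≡⟨ cong₂ _∸_ (count-not+count n S) (+-comm outside 1) ⟩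
        n ∸ suc outside                             ≡⟨ cong (n ∸_) (≡-sym count-representatives) ⟩
        n ∸ count n IsRepresentative                ∎

IsClique⇒adj : ∀ {n} (G : Graph n) {K} → IsClique G K →
  ∀ {u v} → u ∈ K → v ∈ K → u ≢ v → adj G u v ≡ true
IsClique⇒adj G (_  ∷ _)     (here refl) (here refl) u≢u = ⊥-elim (u≢u refl)
IsClique⇒adj G (xK ∷ _)     (here refl) (there v∈K) _   = All.lookup xK v∈K
IsClique⇒adj G (xK ∷ _) {u} (there u∈K) (here refl) _   = trans (sym G u _) (All.lookup xK u∈K)
IsClique⇒adj G (_  ∷ cl)    (there u∈K) (there v∈K) u≢v = IsClique⇒adj G cl u∈K v∈K u≢v

IsClique⇒distinct : ∀ {n} (G : Graph n) {K} → IsClique G K → AllPairs _≢_ K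
IsClique⇒distinct G = AllPairs.map λ { {u} uv refl → loop u uv }
  where
    loop : ∀ u → adj G u u ≡ true → ⊥
    loop u uu with () ← trans (≡-sym uu) (irref G u)

positive-size⇒edge : ∀ {n} (G : Graph n) → 1 ≤ size (edges G) →
  Σ (Fin n) λ u → Σ (Fin n) λ v → adj G u v ≡ true
positive-size⇒edge {n} G pos =
  let u , row-pos = sumFin-positive n _ pos
      v , uv-pos  = sumFin-positive n _ row-pos
  in  u , v , counted⇒adj u v uv-pos
  where
    counted⇒adj : ∀ u v → 1 ≤ (if ⌊ toℕ u <? toℕ v ⌋ then (if adj G u v then 1 else 0) else 0) →
      adj G u v ≡ true
    counted⇒adj u v counted with ⌊ toℕ u <? toℕ v ⌋ | adj G u v
    ... | true  | true  = refl
    ... | true  | false with () ← counted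
    ... | false | _     with () ← counted

module _ {n : ℕ} where
  open DecMembership (_≟_ {n}) using (_∈?_)

  memberOf : List (Fin n) → Fin n → Bool
  memberOf K u = ⌊ u ∈? K ⌋

  memberOf⁺ : ∀ {K u} → u ∈ K → memberOf K u ≡ true
  memberOf⁺ {K} {u} = ⌊⌋-true (u ∈? K)

  memberOf⁻ : ∀ {K u} → memberOf K u ≡ true → u ∈ K
  memberOf⁻ {K} {u} _ with u ∈? K
  ... | yes u∈K = u∈K

completeOn-clique⊆E : ∀ {n} (G : Graph n) {K} → IsClique G K → completeOn (memberOf K) ⊆E G
completeOn-clique⊆E G clique u v joined =
  let u∈K , v∈K , u≢v = completeOn-mem⁻ (memberOf _) joined
  in  IsClique⇒adj G clique (memberOf⁻ u∈K) (memberOf⁻ v∈K) u≢v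

half-square-positive : ∀ {k a} → 2 ≤ k → a * 2 ≡ k * (k ∸ 1) → 1 ≤ a
half-square-positive {a = zero}  (s≤s (s≤s _)) ()
half-square-positive {a = suc _} _              _  = s≤s z≤n

density-bound : ∀ {k a s r} → 2 ≤ k → a * 2 ≡ k * (k ∸ 1) → a * r ≤ s * (k ∸ 1) → k * r ≤ 2 * s
density-bound {suc (suc d)} {a} {s} {r} (s≤s (s≤s _)) a*2 a*r≤ = *-cancelʳ-≤ (k * r) (2 * s) (suc d) (begin
    k * r * suc d    ≡⟨ solve 3 (λ k r e → k :* r :* e := k :* e :* r) refl k r (suc d) ⟩
    k * suc d * r    ≡⟨ cong (_* r) (≡-sym a*2) ⟩
    a * 2 * r        ≡⟨ solve 2 (λ a r → a :* con 2 :* r := con 2 :* (a :* r)) refl a r ⟩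
    2 * (a * r)      ≤⟨ *-monoʳ-≤ 2 a*r≤ ⟩
    2 * (s * suc d)  ≡⟨ solve 2 (λ s e → con 2 :* (s :* e) := con 2 :* s :* e) refl s (suc d) ⟩
    2 * s * suc d    ∎)
  where
    open ≤-Reasoning
    k = suc (suc d)

clique-bound : ∀ {n} (G : Graph n) → UniformlyDense G → ∀ {rE} → IsRank (edges G) rE →
  ∀ {K} → IsClique G K → 2 ≤ length K → length K * rE ≤ 2 * size (edges G)
clique-bound {n} G dense {rE} rankE {K@(x ∷ _)} clique 2≤|K| =
  ≤-trans (*-monoˡ-≤ rE |K|≤k)
    (density-bound {k} {size A} {size (edges G)} 2≤k (size-completeOn*2 S)
      (dense A (completeOn-clique⊆E G clique) (half-square-positive 2≤k (size-completeOn*2 S))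
             (k ∸ 1) rE (rank-completeOn S {x} (memberOf⁺ {K = K} (here refl))) rankE))
  where
    S = memberOf K
    A = completeOn S
    k = count n S
    |K|≤k : length K ≤ k
    |K|≤k = length≤count S (IsClique⇒distinct G clique) (All.tabulate memberOf⁺)
    2≤k : 2 ≤ k
    2≤k = ≤-trans 2≤|K| |K|≤k

proposition3p7 : ∀ (n : ℕ) (G : Graph n) → UniformlyDense G → 1 ≤ size (edges G) →
    ∀ (rE : ℕ) → IsRank (edges G) rE →
    ∀ (K : List (Fin n)) → IsClique G K → length K * rE ≤ 2 * size (edges G)
proposition3p7 _ _ _ _ _ _ [] _ = z≤n
proposition3p7 _ G dense nonempty rE rankE (_ ∷ []) _ =
  let u , v , uv = positive-size⇒edge G nonempty
  in  ≤-trans (*-monoˡ-≤ rE (s≤s (z≤n {1})))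
        (clique-bound G dense {rE} rankE {u ∷ v ∷ []} ((uv All.∷ All.[]) ∷ All.[] ∷ []) (s≤s (s≤s z≤n)))
proposition3p7 _ G dense _ _ rankE (_ ∷ _ ∷ _) clique =
  clique-bound G dense rankE clique (s≤s (s≤s z≤n))
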